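{- Let $n, m$ be positive integers with $m > 1$, and let $T_{n,m} = \sum_{i=0}^{m-1} S_n^i$. Then $T_{n,m}$ is nilpotent over $\mathbb{Z}_m$ if and only if either (i) both $m$ and $n$ are powers of the same prime, or (ii) $m$ has at least two different prime factors and $n \mid m$. Moreover, in either case the nilpotent index of $T_{n,m}$ over $\mathbb{Z}_m$ is at most $n$.
   Context: $S_n$ is the fundamental circulant matrix of order $n$, i.e. the $n\times n$ permutation matrix with $(S_n)_{i,j} = 1$ if $j \equiv i+1 \pmod n$ and $0$ otherwise; $S_n^0 = I_n$ is the identity matrix. $\mathbb{Z}_m$ is the ring of residues modulo $m$; an integer matrix $M$ is nilpotent over $\mathbb{Z}_m$ if $M^k \equiv 0 \pmod m$ (entrywise) for some $k>0$, and its nilpotent index is the least such $k$. -}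

module Defs where

open import Data.Nat using (ℕ; zero; suc; _+_; _*_; _^_; _<_; _≤_; NonZero)
open import Data.Nat.DivMod using (_%_)
open import Data.Nat.Divisibility using (_∣_)
open import Data.Nat.Primality using (Prime)
open import Data.Nat.Properties using (_≟_)
open import Data.Fin using (Fin; toℕ)
open import Data.Bool using (if_then_else_)
open import Data.Product using (Σ; ∃; _×_)
open import Relation.Nullary using (¬_; does)
open import Relation.Binary.PropositionalEquality using (_≡_)

Mat : ℕ → Set
Mat n = Fin n → Fin n → ℕ

∑ : ∀ {n} → (Fin n → ℕ) → ℕ
∑ {zero}  f = 0
∑ {suc n} f = f Fin.zero + ∑ {n} (λ i → f (Fin.suc i))

I : ∀ n → Mat n
I n i j = if does (toℕ i ≟ toℕ j) then 1 else 0

_⊗_ : ∀ {n} → Mat n → Mat n → Mat n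
(A ⊗ B) i j = ∑ (λ k → A i k * B k j)

_⊕_ : ∀ {n} → Mat n → Mat n → Mat n
(A ⊕ B) i j = A i j + B i j

Zero : ∀ n → Mat n
Zero n i j = 0

_^ᴹ_ : ∀ {n} → Mat n → ℕ → Mat n
_^ᴹ_ {n} M zero    = I n
_^ᴹ_ {n} M (suc k) = M ⊗ (M ^ᴹ k)

powSum : ∀ {n} → Mat n → ℕ → Mat n
powSum {n} M zero    = Zero n
powSum {n} M (suc k) = powSum M k ⊕ (M ^ᴹ k)

S : (n : ℕ) → .{{_ : NonZero n}} → Mat n
S n i j = if does (toℕ j ≟ (suc (toℕ i)) % n) then 1 else 0

T : (n m : ℕ) → .{{_ : NonZero n}} → Mat n
T n m = powSum (S n) m

≡0mod : ∀ {n} → Mat n → ℕ → Set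
≡0mod M m = ∀ i j → m ∣ M i j

NilpotentMod : ∀ {n} → Mat n → ℕ → Set
NilpotentMod M m = ∃ λ k → 0 < k × ≡0mod (M ^ᴹ k) m

IsNilpotentIndex : ∀ {n} → Mat n → ℕ → ℕ → Set
IsNilpotentIndex M m k =
  0 < k × ≡0mod (M ^ᴹ k) m × (∀ j → 0 < j → j < k → ¬ ≡0mod (M ^ᴹ j) m)

SamePrimePowers : ℕ → ℕ → Set
SamePrimePowers m n = ∃ λ p → Prime p × (∃ λ a → m ≡ p ^ a) × (∃ λ b → n ≡ p ^ b)

TwoPrimeFactors : ℕ → Set
TwoPrimeFactors m = ∃ λ p → ∃ λ q → Prime p × Prime q × ¬ (p ≡ q) × p ∣ m × q ∣ m

-- Let J = I + S + ⋯ + S^(n-1), so that S J = J and J² = n J.  If n ∣ m, say m = q n, then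
-- T = q J and T² = q m J ≡ 0 (mod m).  If m = p^a and n = p^b, split T = ∏_{c<a} U_c with
-- U_c = ∑_{i<p} S^(i p^c); modulo p the Frobenius map gives U_c^(p^b) ≡ ∑_{i<p} I = p I ≡ 0, so
-- T^n ≡ 0 (mod p^a).  Conversely, let p ∣ m be prime and let L ∣ n with p ∤ L.  Modulo p,
-- T^(p^s) ≡ ∑_{i<m} S^(i p^s) for every s, and we can pick s with p^s ≥ K and p^s ≡ 1 (mod L).
-- Reading the first row of this matrix by column residues mod L counts the i < m in each
-- residue class mod L.  If T^K ≡ 0 (mod m) all these counts vanish mod p; but when L ∤ m the
-- residue classes of 0 and of m have counts differing by exactly 1, so L ∣ m.  Applying this
-- with one prime p ∣ m, and with a second prime q ∣ m when there is one, gives the classification.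
module Submission where

open import Algebra.Bundles using (Semiring)
open import Defs

module BinomialDivisibility where

  open import Data.Nat
  open import Data.Nat.Properties
  open import Data.Nat.Divisibility using (_∣_; divides; ∣⇒≤)
  open import Data.Nat.Primality using (Prime; euclidsLemma)
  open import Data.Nat.Combinatorics using (_C_; nCk+nC[k+1]≡[n+1]C[k+1]; k>n⇒nCk≡0; nC1≡n)
  open import Data.Sum using (inj₁; inj₂)
  open import Relation.Nullary.Negation using (contradiction)
  open import Relation.Binary.PropositionalEquality

  [1+k]*[1+n]C[1+k]≡[1+n]*nCk : ∀ n k → suc k * (suc n C suc k) ≡ suc n * (n C k)
  [1+k]*[1+n]C[1+k]≡[1+n]*nCk zero zero = refl
  [1+k]*[1+n]C[1+k]≡[1+n]*nCk zero (suc k) = begin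
    suc (suc k) * (1 C suc (suc k))   ≡⟨ cong (suc (suc k) *_) (k>n⇒nCk≡0 {1} {suc (suc k)} (s≤s (s≤s z≤n))) ⟩
    suc (suc k) * 0                   ≡⟨ *-zeroʳ (suc (suc k)) ⟩
    0                                 ≡⟨ cong (1 *_) (k>n⇒nCk≡0 {0} {suc k} (s≤s z≤n)) ⟨
    1 * (0 C suc k)                   ∎
    where open ≡-Reasoning
  [1+k]*[1+n]C[1+k]≡[1+n]*nCk (suc n) zero =
    trans (*-identityˡ _) (trans (nC1≡n (suc (suc n))) (sym (*-identityʳ _)))
  [1+k]*[1+n]C[1+k]≡[1+n]*nCk (suc n) (suc k) = begin
    suc (suc k) * (suc (suc n) C suc (suc k))   ≡⟨ cong (suc (suc k) *_) (nCk+nC[k+1]≡[n+1]C[k+1] (suc n) (suc k)) ⟨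
    suc (suc k) * (A + B)                       ≡⟨ *-distribˡ-+ (suc (suc k)) A B ⟩
    suc (suc k) * A + suc (suc k) * B           ≡⟨ cong (suc (suc k) * A +_) ([1+k]*[1+n]C[1+k]≡[1+n]*nCk n (suc k)) ⟩
    A + suc k * A + suc n * (n C suc k)         ≡⟨ cong (λ c → A + c + suc n * (n C suc k)) ([1+k]*[1+n]C[1+k]≡[1+n]*nCk n k) ⟩
    A + suc n * (n C k) + suc n * (n C suc k)   ≡⟨ +-assoc A _ _ ⟩
    A + (suc n * (n C k) + suc n * (n C suc k)) ≡⟨ cong (A +_) (*-distribˡ-+ (suc n) (n C k) (n C suc k)) ⟨
    A + suc n * (n C k + n C suc k)             ≡⟨ cong (λ c → A + suc n * c) (nCk+nC[k+1]≡[n+1]C[k+1] n k) ⟩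
    A + suc n * A                               ∎
    where
    open ≡-Reasoning
    A : ℕ
    A = suc n C suc k
    B : ℕ
    B = suc n C suc (suc k)

  prime∣pCk : ∀ {p} → Prime p → ∀ {k} → 0 < k → k < p → p ∣ p C k
  prime∣pCk {suc n} pr {suc k} _ k<p
    with euclidsLemma (suc k) (suc n C suc k) pr
           (divides (n C k) (trans ([1+k]*[1+n]C[1+k]≡[1+n]*nCk n k) (*-comm (suc n) (n C k))))
  ... | inj₁ p∣k = contradiction (∣⇒≤ p∣k) (<⇒≱ k<p)
  ... | inj₂ p∣C = p∣C

open BinomialDivisibility

module GeometricSums {c ℓ} (R : Semiring c ℓ) where

  open import Data.Nat as ℕ using (ℕ; zero; suc; z<s; s<s)
  import Data.Nat.Properties as ℕ
  open import Data.Nat.Divisibility using (_∣_)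
  open import Data.Nat.Primality using (Prime; prime⇒nonZero; ¬prime[0]; ¬prime[1])
  open import Data.Nat.Combinatorics using (_C_; nCn≡1)
  open import Data.Fin as Fin using (Fin; toℕ; fromℕ)
  open import Data.Fin.Properties using (toℕ-fromℕ; toℕ-inject₁; toℕ<n)
  open import Data.Vec.Functional using (replicate; init; tail)
  open import Relation.Nullary.Negation using (contradiction)
  open import Relation.Binary.PropositionalEquality as ≡ using (_≡_)
  import Algebra.Properties.Semiring.Binomial as Binomial

  open Semiring R
  open import Algebra.Properties.Semiring.Exp R
  open import Algebra.Properties.Semiring.Mult R
  open import Algebra.Properties.Monoid.Sum +-monoid using (sum; sum-init-last; sum-cong-≋; sum-replicate-zero)
  open import Relation.Binary.Reasoning.Setoid setoid

  geom : Carrier → ℕ → Carrier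
  geom x zero = 0#
  geom x (suc k) = geom x k + x ^ k

  geom-congˡ : ∀ {x y} k → x ≈ y → geom x k ≈ geom y k
  geom-congˡ zero x≈y = refl
  geom-congˡ (suc k) x≈y = +-cong (geom-congˡ k x≈y) (^-congˡ k x≈y)

  1^k≈1 : ∀ k → 1# ^ k ≈ 1#
  1^k≈1 zero = refl
  1^k≈1 (suc k) = trans (*-identityˡ _) (1^k≈1 k)

  geom-1 : ∀ k → geom 1# k ≈ k × 1#
  geom-1 zero = refl
  geom-1 (suc k) = trans (+-cong (geom-1 k) (1^k≈1 k)) (+-comm _ _)

  geom-+ : ∀ x a b → geom x (a ℕ.+ b) ≈ geom x a + x ^ a * geom x b
  geom-+ x a zero = begin
    geom x (a ℕ.+ 0)        ≡⟨ ≡.cong (geom x) (ℕ.+-identityʳ a) ⟩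
    geom x a                ≈⟨ +-identityʳ _ ⟨
    geom x a + 0#           ≈⟨ +-congˡ (zeroʳ _) ⟨
    geom x a + x ^ a * 0#   ∎
  geom-+ x a (suc b) = begin
    geom x (a ℕ.+ suc b)                            ≡⟨ ≡.cong (geom x) (ℕ.+-suc a b) ⟩
    geom x (a ℕ.+ b) + x ^ (a ℕ.+ b)                ≈⟨ +-cong (geom-+ x a b) (^-homo-* x a b) ⟩
    (geom x a + x ^ a * geom x b) + x ^ a * x ^ b   ≈⟨ +-assoc _ _ _ ⟩
    geom x a + (x ^ a * geom x b + x ^ a * x ^ b)   ≈⟨ +-congˡ (distribˡ _ _ _) ⟨
    geom x a + x ^ a * geom x (suc b)               ∎

  geom-suc : ∀ x k → geom x (suc k) ≈ 1# + x * geom x k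
  geom-suc x k = begin
    geom x (1 ℕ.+ k)                ≈⟨ geom-+ x 1 k ⟩
    (0# + 1#) + x * 1# * geom x k   ≈⟨ +-cong (+-identityˡ 1#) (*-congʳ (*-identityʳ x)) ⟩
    1# + x * geom x k               ∎

  geom-* : ∀ x k N → geom x (k ℕ.* N) ≈ geom (x ^ N) k * geom x N
  geom-* x zero N = sym (zeroˡ _)
  geom-* x (suc k) N = begin
    geom x (N ℕ.+ k ℕ.* N)                              ≡⟨ ≡.cong (geom x) (ℕ.+-comm N (k ℕ.* N)) ⟩
    geom x (k ℕ.* N ℕ.+ N)                              ≈⟨ geom-+ x (k ℕ.* N) N ⟩
    geom x (k ℕ.* N) + x ^ (k ℕ.* N) * geom x N         ≈⟨ +-cong (geom-* x k N) (*-congʳ xᴺᵏ) ⟩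
    geom (x ^ N) k * geom x N + (x ^ N) ^ k * geom x N  ≈⟨ distribʳ _ _ _ ⟨
    geom (x ^ N) (suc k) * geom x N                     ∎
    where
    xᴺᵏ : x ^ (k ℕ.* N) ≈ (x ^ N) ^ k
    xᴺᵏ = sym (trans (^-assocʳ x N k) (^-congʳ x (ℕ.*-comm N k)))

  ^-absorbs : ∀ a {K} N → K ℕ.≤ N → a ^ K ≈ 0# → a ^ N ≈ 0#
  ^-absorbs a {K} N K≤N aᴷ≈0 = begin
    a ^ N                   ≡⟨ ≡.cong (a ^_) (ℕ.m∸n+n≡m K≤N) ⟨
    a ^ (N ℕ.∸ K ℕ.+ K)     ≈⟨ ^-homo-* a (N ℕ.∸ K) K ⟩
    a ^ (N ℕ.∸ K) * a ^ K   ≈⟨ *-congˡ aᴷ≈0 ⟩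
    a ^ (N ℕ.∸ K) * 0#      ≈⟨ zeroʳ _ ⟩
    0#                      ∎

  Commute : Carrier → Carrier → Set ℓ
  Commute a b = a * b ≈ b * a

  commute-^ʳ : ∀ {a b} → Commute a b → ∀ k → Commute a (b ^ k)
  commute-^ʳ ab zero = trans (*-identityʳ _) (sym (*-identityˡ _))
  commute-^ʳ {a} {b} ab (suc k) = begin
    a * (b * b ^ k)   ≈⟨ *-assoc _ _ _ ⟨
    a * b * b ^ k     ≈⟨ *-congʳ ab ⟩
    b * a * b ^ k     ≈⟨ *-assoc _ _ _ ⟩
    b * (a * b ^ k)   ≈⟨ *-congˡ (commute-^ʳ ab k) ⟩
    b * (b ^ k * a)   ≈⟨ *-assoc _ _ _ ⟨
    b * b ^ k * a     ∎

  commute-geomʳ : ∀ {a b} → Commute a b → ∀ k → Commute a (geom b k)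
  commute-geomʳ ab zero = trans (zeroʳ _) (sym (zeroˡ _))
  commute-geomʳ {a} {b} ab (suc k) = begin
    a * (geom b k + b ^ k)      ≈⟨ distribˡ _ _ _ ⟩
    a * geom b k + a * b ^ k    ≈⟨ +-cong (commute-geomʳ ab k) (commute-^ʳ ab k) ⟩
    geom b k * a + b ^ k * a    ≈⟨ distribʳ _ _ _ ⟨
    (geom b k + b ^ k) * a      ∎

  commute-*-^ : ∀ {a b} → Commute a b → ∀ k → (a * b) ^ k ≈ a ^ k * b ^ k
  commute-*-^ ab zero = sym (*-identityˡ _)
  commute-*-^ {a} {b} ab (suc k) = begin
    a * b * (a * b) ^ k         ≈⟨ *-congˡ (commute-*-^ ab k) ⟩
    a * b * (a ^ k * b ^ k)     ≈⟨ *-assoc _ _ _ ⟩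
    a * (b * (a ^ k * b ^ k))   ≈⟨ *-congˡ (*-assoc _ _ _) ⟨
    a * (b * a ^ k * b ^ k)     ≈⟨ *-congˡ (*-congʳ (commute-^ʳ (sym ab) k)) ⟩
    a * (a ^ k * b * b ^ k)     ≈⟨ *-congˡ (*-assoc _ _ _) ⟩
    a * (a ^ k * (b * b ^ k))   ≈⟨ *-assoc _ _ _ ⟨
    a * a ^ k * (b * b ^ k)     ∎

  x*geom≈geom : ∀ {x} N → x ^ N ≈ 1# → x * geom x N ≈ geom x N
  x*geom≈geom zero _ = zeroʳ _
  x*geom≈geom {x} (suc M) xᴺ≈1 = begin
    x * (geom x M + x ^ M)   ≈⟨ distribˡ _ _ _ ⟩
    x * geom x M + x ^ suc M ≈⟨ +-congˡ xᴺ≈1 ⟩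
    x * geom x M + 1#        ≈⟨ +-comm _ _ ⟩
    1# + x * geom x M        ≈⟨ geom-suc x M ⟨
    geom x (suc M)           ∎

  module Periodic {x : Carrier} (N : ℕ) (xᴺ≈1 : x ^ N ≈ 1#) where

    J : Carrier
    J = geom x N

    J*x^k≈J : ∀ k → J * x ^ k ≈ J
    J*x^k≈J zero = *-identityʳ J
    J*x^k≈J (suc k) = begin
      J * (x * x ^ k)   ≈⟨ *-assoc _ _ _ ⟨
      J * x * x ^ k     ≈⟨ *-congʳ (trans (sym (commute-geomʳ refl N)) (x*geom≈geom N xᴺ≈1)) ⟩
      J * x ^ k         ≈⟨ J*x^k≈J k ⟩
      J                 ∎

    J*geom≈k×J : ∀ k → J * geom x k ≈ k × J
    J*geom≈k×J zero = zeroʳ J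
    J*geom≈k×J (suc k) = begin
      J * (geom x k + x ^ k)     ≈⟨ distribˡ _ _ _ ⟩
      J * geom x k + J * x ^ k   ≈⟨ +-cong (J*geom≈k×J k) (J*x^k≈J k) ⟩
      k × J + J                  ≈⟨ +-comm _ _ ⟩
      suc k × J                  ∎

    geom-*N≈×J : ∀ q → geom x (q ℕ.* N) ≈ q × J
    geom-*N≈×J q = begin
      geom x (q ℕ.* N)     ≈⟨ geom-* x q N ⟩
      geom (x ^ N) q * J   ≈⟨ *-congʳ (trans (geom-congˡ q xᴺ≈1) (geom-1 q)) ⟩
      (q × 1#) * J         ≈⟨ ×-assoc-* q 1# J ⟩
      q × (1# * J)         ≈⟨ ×-congʳ q (*-identityˡ J) ⟩
      q × J                ∎

    geom-*N-squared : ∀ q → geom x (q ℕ.* N) ^ 2 ≈ (q ℕ.* (q ℕ.* N)) × J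
    geom-*N-squared q = begin
      G * (G * 1#)               ≈⟨ *-cong (geom-*N≈×J q) (trans (*-identityʳ G) (geom-*N≈×J q)) ⟩
      (q × J) * (q × J)          ≈⟨ ×-assoc-* q J (q × J) ⟩
      q × (J * (q × J))          ≈⟨ ×-congʳ q (×-comm-* q J J) ⟩
      q × (q × (J * J))          ≈⟨ ×-congʳ q (×-congʳ q (J*geom≈k×J N)) ⟩
      q × (q × (N × J))          ≈⟨ ×-congʳ q (×-assocˡ J q N) ⟩
      q × ((q ℕ.* N) × J)        ≈⟨ ×-assocˡ J q (q ℕ.* N) ⟩
      (q ℕ.* (q ℕ.* N)) × J      ∎
      where G = geom x (q ℕ.* N)

  0#^≈0# : ∀ k → .{{ℕ.NonZero k}} → 0# ^ k ≈ 0#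
  0#^≈0# (suc k) = zeroˡ _

  frobenius : ∀ {p} → Prime p → (∀ {c} → p ∣ c → ∀ z → c × z ≈ 0#) →
              ∀ {x y} → Commute x y → (x + y) ^ p ≈ x ^ p + y ^ p
  frobenius {zero} pr = contradiction pr ¬prime[0]
  frobenius {suc zero} pr = contradiction pr ¬prime[1]
  frobenius {P@(suc (suc q))} pr p∣⇒×≈0 {x} {y} xy = begin
    (x + y) ^ P                                        ≈⟨ theorem xy P ⟩
    term Fin.zero + sum (tail term)                    ≈⟨ +-cong first (sum-init-last (tail term)) ⟩
    y ^ P + (sum (init (tail term)) + term (fromℕ P))  ≈⟨ +-congˡ (+-cong middle (last (toℕ (fromℕ P)) (toℕ-fromℕ P))) ⟩
    y ^ P + (0# + x ^ P)                               ≈⟨ +-congˡ (+-identityˡ _) ⟩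
    y ^ P + x ^ P                                      ≈⟨ +-comm _ _ ⟩
    x ^ P + y ^ P                                      ∎
    where
    open Binomial R x y using (theorem; binomialTerm)
    term : Fin (suc P) → Carrier
    term = binomialTerm P
    first : term Fin.zero ≈ y ^ P
    first = trans (×-homo-1 _) (*-identityˡ _)
    last : ∀ k → k ≡ P → (P C k) × (x ^ k * y ^ (P ℕ.∸ k)) ≈ x ^ P
    last k ≡.refl = begin
      (P C P) × (x ^ P * y ^ (P ℕ.∸ P))   ≈⟨ ×-cong (nCn≡1 P) (*-congˡ (^-congʳ y (ℕ.n∸n≡0 P))) ⟩
      1 × (x ^ P * 1#)                    ≈⟨ ×-homo-1 _ ⟩
      x ^ P * 1#                          ≈⟨ *-identityʳ _ ⟩
      x ^ P                               ∎
    inner-vanishes : ∀ (i : Fin (suc q)) → init (tail term) i ≈ 0#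
    inner-vanishes i = p∣⇒×≈0 (prime∣pCk pr z<s (s<s i<1+q)) _
      where i<1+q = ≡.subst (ℕ._< suc q) (≡.sym (toℕ-inject₁ i)) (toℕ<n i)
    middle : sum (init (tail term)) ≈ 0#
    middle = trans (sum-cong-≋ {suc q} {_} {replicate (suc q) 0#} inner-vanishes) (sum-replicate-zero (suc q))

  module CharacteristicPrime {p} (pr : Prime p) (p∣⇒×≈0 : ∀ {c} → p ∣ c → ∀ z → c × z ≈ 0#) where

    instance
      _ = prime⇒nonZero pr

    geom-^p : ∀ x k → geom x k ^ p ≈ geom (x ^ p) k
    geom-^p x zero = 0#^≈0# p
    geom-^p x (suc k) = begin
      (geom x k + x ^ k) ^ p          ≈⟨ frobenius pr p∣⇒×≈0 (sym (commute-geomʳ (sym (commute-^ʳ refl k)) k)) ⟩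
      geom x k ^ p + (x ^ k) ^ p      ≈⟨ +-cong (geom-^p x k) xᵏᵖ ⟩
      geom (x ^ p) k + (x ^ p) ^ k    ∎
      where
      xᵏᵖ : (x ^ k) ^ p ≈ (x ^ p) ^ k
      xᵏᵖ = trans (^-assocʳ x k p) (trans (^-congʳ x (ℕ.*-comm k p)) (sym (^-assocʳ x p k)))

    geom-^p^s : ∀ s x k → geom x k ^ (p ℕ.^ s) ≈ geom (x ^ (p ℕ.^ s)) k
    geom-^p^s zero x k = trans (*-identityʳ _) (geom-congˡ k (sym (*-identityʳ x)))
    geom-^p^s (suc s) x k = begin
      geom x k ^ (p ℕ.* p ℕ.^ s)       ≡⟨ ≡.cong (geom x k ^_) (ℕ.*-comm p (p ℕ.^ s)) ⟩
      geom x k ^ (p ℕ.^ s ℕ.* p)       ≈⟨ ^-assocʳ _ (p ℕ.^ s) p ⟨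
      (geom x k ^ (p ℕ.^ s)) ^ p       ≈⟨ ^-congˡ p (geom-^p^s s x k) ⟩
      geom (x ^ (p ℕ.^ s)) k ^ p       ≈⟨ geom-^p _ k ⟩
      geom ((x ^ (p ℕ.^ s)) ^ p) k     ≈⟨ geom-congˡ k (trans (^-assocʳ x (p ℕ.^ s) p) (^-congʳ x (ℕ.*-comm (p ℕ.^ s) p))) ⟩
      geom (x ^ (p ℕ.* p ℕ.^ s)) k     ∎

open import Data.Nat
open import Data.Nat.Properties
open import Data.Nat.DivMod
open import Data.Nat.Divisibility
open import Data.Nat.Primality
open import Data.Nat.Coprimality as Coprime using (Coprime; coprime-divisor)
open import Data.Nat.LCM using (lcm; lcm-least; gcd*lcm)
open import Data.Nat.Induction using (<-rec)
open import Data.Nat.Primality.Factorisation using (factorise)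
open import Data.Nat.ListAction using (product)
open import Data.List using ([]; _∷_)
open import Data.List.Relation.Unary.All using (_∷_)
open import Data.Bool using (if_then_else_)
open import Data.Fin as Fin using (Fin; toℕ; fromℕ<)
open import Data.Fin.Properties using (pigeonhole; toℕ<n; toℕ-fromℕ<; fromℕ<-toℕ; all?)
open import Data.Product using (∃; ∃₂; _×_; _,_)
open import Data.Sum using (_⊎_; inj₁; inj₂; [_,_]′)
open import Function using (_∘_)
open import Function.Bundles using (_⇔_; mk⇔)
open import Relation.Nullary using (¬_; Dec; does; yes; no)
open import Relation.Nullary.Negation using (contradiction)
open import Relation.Binary.PropositionalEquality hiding (J)
open import Algebra.Structures using (IsSemiring)
open import Algebra.Properties.CommutativeSemigroup +-commutativeSemigroup using (interchange)
import Relation.Binary.Reasoning.Setoid as SetoidReasoning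

prime-factor : ∀ {m} → 1 < m → ∃ λ p → Prime p × p ∣ m
prime-factor {m} 1<m with factorise m {{>-nonZero (<-trans z<s 1<m)}}
... | record { factors = [] ; isFactorisation = m≡1 } = contradiction m≡1 (>⇒≢ 1<m)
... | record { factors = p ∷ ps ; isFactorisation = m≡ ; factorsPrime = pr ∷ _ } =
  p , pr , divides (product ps) (trans m≡ (*-comm p (product ps)))

split-prime-power : ∀ {p} → Prime p → ∀ n → .{{NonZero n}} → ∃₂ λ β L → n ≡ p ^ β * L × ¬ p ∣ L
split-prime-power {p} pr = <-rec _ split
  where
  instance
    _ = prime⇒nonTrivial pr
  split : ∀ n → (∀ {k} → k < n → .{{NonZero k}} → ∃₂ λ β L → k ≡ p ^ β * L × ¬ p ∣ L) →
          .{{NonZero n}} → ∃₂ λ β L → n ≡ p ^ β * L × ¬ p ∣ L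
  split n rec with p ∣? n
  ... | no p∤n = 0 , n , sym (+-identityʳ n) , p∤n
  ... | yes p∣n with rec (quotient-< p∣n) {{quotient≢0 p∣n}}
  ...   | β , L , q≡pᵝL , p∤L = suc β , L , n≡ppᵝL , p∤L
    where
    open ≡-Reasoning
    n≡ppᵝL : n ≡ p * p ^ β * L
    n≡ppᵝL = begin
      n                   ≡⟨ m∣n⇒n≡m*quotient p∣n ⟩
      p * quotient p∣n    ≡⟨ cong (p *_) q≡pᵝL ⟩
      p * (p ^ β * L)     ≡⟨ *-assoc p (p ^ β) L ⟨
      p * p ^ β * L       ∎

∣-nonZero : ∀ {d n} .{{_ : NonZero n}} → d ∣ n → NonZero d
∣-nonZero (divides q refl) = m*n≢0⇒n≢0 q

prime∤⇒coprime : ∀ {p n} → Prime p → ¬ p ∣ n → Coprime p n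
prime∤⇒coprime pr p∤n (d∣p , d∣n) with prime⇒irreducible pr d∣p
... | inj₁ d≡1 = d≡1
... | inj₂ refl = contradiction d∣n p∤n

distinct-primes⇒coprime : ∀ {p q} → Prime p → Prime q → p ≢ q → Coprime p q
distinct-primes⇒coprime {p} {q} pp pq p≢q = prime∤⇒coprime pp p∤q
  where
  p∤q : ¬ p ∣ q
  p∤q p∣q with prime⇒irreducible pq p∣q
  ... | inj₁ refl = ¬prime[1] pp
  ... | inj₂ p≡q = p≢q p≡q

coprime-*ˡ : ∀ {a b c} → Coprime a c → Coprime b c → Coprime (a * b) c
coprime-*ˡ ac bc (d∣ab , d∣c) = bc (coprime-divisor (λ (e∣d , e∣a) → ac (e∣a , ∣-trans e∣d d∣c)) d∣ab , d∣c)

coprime-^ˡ : ∀ {a c} → Coprime a c → ∀ k → Coprime (a ^ k) c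
coprime-^ˡ ac zero = Coprime.1-coprimeTo _
coprime-^ˡ ac (suc k) = coprime-*ˡ ac (coprime-^ˡ ac k)

coprime-^ : ∀ {a c} → Coprime a c → ∀ k l → Coprime (a ^ k) (c ^ l)
coprime-^ ac k l = Coprime.sym (coprime-^ˡ (Coprime.sym (coprime-^ˡ ac k)) l)

coprime⇒*∣ : ∀ {a b c} → Coprime a b → a ∣ c → b ∣ c → a * b ∣ c
coprime⇒*∣ {a} {b} ab a∣c b∣c = subst (_∣ _) lcm≡ab (lcm-least a∣c b∣c)
  where
  lcm≡ab : lcm a b ≡ a * b
  lcm≡ab = trans (sym (*-identityˡ (lcm a b)))
             (trans (cong (_* lcm a b) (sym (Coprime.coprime⇒gcd≡1 ab))) (gcd*lcm a b))

coprime-parts∣⇒classification :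
  ∀ {m n} .{{_ : NonZero m}} .{{_ : NonZero n}} → 1 < m →
  (∀ {p L} → Prime p → p ∣ m → L ∣ n → ¬ p ∣ L → L ∣ m) →
  SamePrimePowers m n ⊎ (TwoPrimeFactors m × n ∣ m)
coprime-parts∣⇒classification {m} {n} 1<m coprime-part∣m
  with prime-factor 1<m
... | p , pr , p∣m
  with split-prime-power pr n | split-prime-power pr m
... | β , L , n≡pᵝL , p∤L | α , M , m≡pᵅM , p∤M
  with coprime-part∣m pr p∣m (divides (p ^ β) n≡pᵝL) p∤L | M ≟ 1
... | L∣m | yes refl = inj₁ (p , pr , (α , m≡pᵅ) , (β , n≡pᵝ))
  where
  m≡pᵅ : m ≡ p ^ α
  m≡pᵅ = trans m≡pᵅM (*-identityʳ _)
  L≡1 : L ≡ 1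
  L≡1 = coprime-^ˡ (prime∤⇒coprime pr p∤L) α (subst (L ∣_) m≡pᵅ L∣m , ∣-refl)
  n≡pᵝ : n ≡ p ^ β
  n≡pᵝ = trans n≡pᵝL (trans (cong (p ^ β *_) L≡1) (*-identityʳ _))
... | L∣m | no M≢1
  with prime-factor (≤∧≢⇒< 0<M (M≢1 ∘ sym))
  where
  0<M : 0 < M
  0<M = n≢0⇒n>0 λ { refl → ≢-nonZero⁻¹ m (trans m≡pᵅM (*-zeroʳ (p ^ α))) }
... | q , qr , q∣M
  with split-prime-power qr n
... | γ , L′ , n≡qᵞL′ , q∤L′ = inj₂ ((p , q , pr , qr , p≢q , p∣m , q∣m) , n∣m)
  where
  q∣m : q ∣ m
  q∣m = subst (q ∣_) (sym m≡pᵅM) (∣n⇒∣m*n (p ^ α) q∣M)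
  p≢q : p ≢ q
  p≢q refl = p∤M q∣M
  pᵝ∣L′ : p ^ β ∣ L′
  pᵝ∣L′ = coprime-divisor (coprime-^ (distinct-primes⇒coprime pr qr p≢q) β γ)
            (subst (p ^ β ∣_) n≡qᵞL′ (subst (p ^ β ∣_) (sym n≡pᵝL) (m∣m*n L)))
  pᵝ∣m : p ^ β ∣ m
  pᵝ∣m = ∣-trans pᵝ∣L′ (coprime-part∣m qr q∣m (divides (q ^ γ) n≡qᵞL′) q∤L′)
  n∣m : n ∣ m
  n∣m = subst (_∣ m) (sym n≡pᵝL) (coprime⇒*∣ (coprime-^ˡ (prime∤⇒coprime pr p∤L) β) pᵝ∣m L∣m)

n≤m^n : ∀ {m} → 1 < m → ∀ n → n ≤ m ^ n
n≤m^n 1<m zero = z≤n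
n≤m^n {m} 1<m (suc n) = ≤-trans (s≤s (n≤m^n 1<m n)) (^-monoʳ-< m 1<m (n<1+n n))

%≡%⇒∣∸ : ∀ a b d .{{_ : NonZero d}} → a % d ≡ b % d → d ∣ a ∸ b
%≡%⇒∣∸ a b d a≡b = divides (a / d ∸ b / d) (begin
  a ∸ b                                       ≡⟨ cong₂ _∸_ (m≡m%n+[m/n]*n a d) (m≡m%n+[m/n]*n b d) ⟩
  (a % d + a / d * d) ∸ (b % d + b / d * d)   ≡⟨ cong (λ r → (a % d + a / d * d) ∸ (r + b / d * d)) a≡b ⟨
  (a % d + a / d * d) ∸ (a % d + b / d * d)   ≡⟨ [m+n]∸[m+o]≡n∸o (a % d) _ _ ⟩
  a / d * d ∸ b / d * d                       ≡⟨ *-distribʳ-∸ d (a / d) (b / d) ⟨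
  (a / d ∸ b / d) * d                         ∎)
  where open ≡-Reasoning

+-cong-% : ∀ d .{{_ : NonZero d}} {a a′ b b′} → a % d ≡ a′ % d → b % d ≡ b′ % d → (a + b) % d ≡ (a′ + b′) % d
+-cong-% d {a} {a′} {b} {b′} a≡a′ b≡b′ = begin
  (a + b) % d                ≡⟨ %-distribˡ-+ a b d ⟩
  (a % d + b % d) % d        ≡⟨ cong₂ (λ x y → (x + y) % d) a≡a′ b≡b′ ⟩
  (a′ % d + b′ % d) % d      ≡⟨ %-distribˡ-+ a′ b′ d ⟨
  (a′ + b′) % d              ∎
  where open ≡-Reasoning

*-cong-% : ∀ d .{{_ : NonZero d}} {a a′ b b′} → a % d ≡ a′ % d → b % d ≡ b′ % d → a * b % d ≡ a′ * b′ % d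
*-cong-% d {a} {a′} {b} {b′} a≡a′ b≡b′ = begin
  a * b % d                  ≡⟨ %-distribˡ-* a b d ⟩
  (a % d) * (b % d) % d      ≡⟨ cong₂ (λ x y → x * y % d) a≡a′ b≡b′ ⟩
  (a′ % d) * (b′ % d) % d    ≡⟨ %-distribˡ-* a′ b′ d ⟨
  a′ * b′ % d                ∎
  where open ≡-Reasoning

*-%≡1 : ∀ {x} d .{{_ : NonZero d}} → x % d ≡ 1 % d → ∀ y → x * y % d ≡ y % d
*-%≡1 {x} d x≡1 y = trans (*-cong-% d {b = y} x≡1 refl) (cong (_% d) (*-identityˡ y))

^-%≡1 : ∀ {x} d .{{_ : NonZero d}} → x % d ≡ 1 % d → ∀ k → x ^ k % d ≡ 1 % d
^-%≡1 d x≡1 zero = refl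
^-%≡1 {x} d x≡1 (suc k) = trans (*-%≡1 d x≡1 (x ^ k)) (^-%≡1 d x≡1 k)

prime-power≡1-mod : ∀ {p} → Prime p → ∀ L .{{_ : NonZero L}} → ¬ p ∣ L →
                    ∃ λ e → 0 < e × p ^ e % L ≡ 1 % L
-- Two of p^0, …, p^L agree mod L; cancelling p^a, which is coprime to L, leaves p^(b ∸ a) ≡ 1.
prime-power≡1-mod {p} pr L p∤L
  with pigeonhole (n<1+n L) (λ (i : Fin (suc L)) → fromℕ< (m%n<n (p ^ toℕ i) L))
... | i , j , i<j , same = b ∸ a , m<n⇒0<n∸m i<j , pᵉ≡1
  where
  instance
    _ = prime⇒nonZero pr
  open ≡-Reasoning
  a : ℕ
  a = toℕ i
  b : ℕ
  b = toℕ j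
  e : ℕ
  e = b ∸ a
  pᵇ≡pᵃ : p ^ b % L ≡ p ^ a % L
  pᵇ≡pᵃ = sym (trans (sym (toℕ-fromℕ< _)) (trans (cong toℕ same) (toℕ-fromℕ< _)))
  pᵇ∸pᵃ : p ^ b ∸ p ^ a ≡ p ^ a * (p ^ e ∸ 1)
  pᵇ∸pᵃ = begin
    p ^ b ∸ p ^ a                 ≡⟨ cong (λ c → p ^ c ∸ p ^ a) (m+[n∸m]≡n (<⇒≤ i<j)) ⟨
    p ^ (a + e) ∸ p ^ a           ≡⟨ cong₂ _∸_ (^-distribˡ-+-* p a e) (sym (*-identityʳ (p ^ a))) ⟩
    p ^ a * p ^ e ∸ p ^ a * 1     ≡⟨ *-distribˡ-∸ (p ^ a) (p ^ e) 1 ⟨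
    p ^ a * (p ^ e ∸ 1)           ∎
  L∣pᵉ∸1 : L ∣ p ^ e ∸ 1
  L∣pᵉ∸1 = coprime-divisor (Coprime.sym (coprime-^ˡ (prime∤⇒coprime pr p∤L) a))
             (subst (L ∣_) pᵇ∸pᵃ (%≡%⇒∣∸ (p ^ b) (p ^ a) L pᵇ≡pᵃ))
  pᵉ≡1 : p ^ e % L ≡ 1 % L
  pᵉ≡1 = begin
    p ^ e % L               ≡⟨ cong (_% L) (m+[n∸m]≡n (m^n>0 p e)) ⟨
    (1 + (p ^ e ∸ 1)) % L   ≡⟨ %-remove-+ʳ 1 L∣pᵉ∸1 ⟩
    1 % L                   ∎

large-prime-power≡1-mod : ∀ {p} → Prime p → ∀ L .{{_ : NonZero L}} → ¬ p ∣ L →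
                          ∀ K → ∃ λ s → K ≤ p ^ s × p ^ s % L ≡ 1 % L
large-prime-power≡1-mod {p} pr L p∤L K with prime-power≡1-mod pr L p∤L
... | e , 0<e , pᵉ≡1 =
  e * K ,
  ≤-trans (m≤n*m K e {{>-nonZero 0<e}}) (n≤m^n (nonTrivial⇒n>1 p {{prime⇒nonTrivial pr}}) (e * K)) ,
  trans (cong (_% L) (sym (^-*-assoc p e K))) (^-%≡1 L pᵉ≡1 K)

-- I and S in Defs test their entries with exactly this δ, so they unfold to δ-values.
δ : ℕ → ℕ → ℕ
δ x y = if does (x ≟ y) then 1 else 0

δ-refl : ∀ x → δ x x ≡ 1
δ-refl zero = refl
δ-refl (suc x) = δ-refl x

δ-≢ : ∀ {x y} → x ≢ y → δ x y ≡ 0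
δ-≢ {zero} {zero} x≢y = contradiction refl x≢y
δ-≢ {zero} {suc y} x≢y = refl
δ-≢ {suc x} {zero} x≢y = refl
δ-≢ {suc x} {suc y} x≢y = δ-≢ (x≢y ∘ cong suc)

δ-sym : ∀ x y → δ x y ≡ δ y x
δ-sym zero zero = refl
δ-sym zero (suc y) = refl
δ-sym (suc x) zero = refl
δ-sym (suc x) (suc y) = δ-sym x y

sum< : ℕ → (ℕ → ℕ) → ℕ
sum< zero f = 0
sum< (suc k) f = sum< k f + f k

sum<-cong : ∀ k {f g} → (∀ i → i < k → f i ≡ g i) → sum< k f ≡ sum< k g
sum<-cong zero f≡g = refl
sum<-cong (suc k) f≡g = cong₂ _+_ (sum<-cong k (λ i i<k → f≡g i (m<n⇒m<1+n i<k))) (f≡g k (n<1+n k))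

sum<-+ : ∀ a b f → sum< (a + b) f ≡ sum< a f + sum< b (λ i → f (a + i))
sum<-+ a zero f = trans (cong (λ c → sum< c f) (+-identityʳ a)) (sym (+-identityʳ _))
sum<-+ a (suc b) f = begin
  sum< (a + suc b) f                                ≡⟨ cong (λ c → sum< c f) (+-suc a b) ⟩
  sum< (a + b) f + f (a + b)                        ≡⟨ cong (_+ f (a + b)) (sum<-+ a b f) ⟩
  sum< a f + sum< b (λ i → f (a + i)) + f (a + b)   ≡⟨ +-assoc (sum< a f) _ _ ⟩
  sum< a f + sum< (suc b) (λ i → f (a + i))         ∎
  where open ≡-Reasoning

sum<-% : ∀ k d .{{_ : NonZero d}} {f g} → (∀ i → f i % d ≡ g i % d) → sum< k f % d ≡ sum< k g % d
sum<-% zero d f≡g = refl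
sum<-% (suc k) d f≡g = +-cong-% d (sum<-% k d f≡g) (f≡g k)

sum<-δ-≥ : ∀ k t → k ≤ t → sum< k (λ i → δ i t) ≡ 0
sum<-δ-≥ zero t _ = refl
sum<-δ-≥ (suc k) t k<t = cong₂ _+_ (sum<-δ-≥ k t (<⇒≤ k<t)) (δ-≢ (<⇒≢ k<t))

sum<-δ-< : ∀ k t → t < k → sum< k (λ i → δ i t) ≡ 1
sum<-δ-< (suc k) t t<1+k with m≤n⇒m<n∨m≡n (s≤s⁻¹ t<1+k)
... | inj₁ t<k = cong₂ _+_ (sum<-δ-< k t t<k) (δ-≢ (>⇒≢ t<k))
... | inj₂ refl = cong₂ _+_ (sum<-δ-≥ k k ≤-refl) (δ-refl k)

module Residues (L : ℕ) .{{_ : NonZero L}} where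

  count : ℕ → ℕ → ℕ
  count k r = sum< k (λ i → δ (i % L) r)

  count-≤ : ∀ k r → k ≤ L → count k r ≡ sum< k (λ i → δ i r)
  count-≤ k r k≤L = sum<-cong k (λ i i<k → cong (λ c → δ c r) (m<n⇒m%n≡m (<-≤-trans i<k k≤L)))

  count-L+ : ∀ k r → r < L → count (L + k) r ≡ 1 + count k r
  count-L+ k r r<L = begin
    count (L + k) r                                   ≡⟨ sum<-+ L k _ ⟩
    count L r + sum< k (λ i → δ ((L + i) % L) r)      ≡⟨ cong₂ _+_ (trans (count-≤ L r ≤-refl) (sum<-δ-< L r r<L))
                                                                    (sum<-cong k (λ i _ → cong (λ c → δ c r) L+i≡i)) ⟩
    1 + count k r                                     ∎
    where
    open ≡-Reasoning
    L+i≡i : ∀ {i} → (L + i) % L ≡ i % L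
    L+i≡i {i} = trans (cong (_% L) (+-comm L i)) ([m+n]%n≡m%n i L)

  count-*L+ : ∀ q k r → r < L → count (q * L + k) r ≡ q + count k r
  count-*L+ zero k r r<L = refl
  count-*L+ (suc q) k r r<L = begin
    count (L + q * L + k) r     ≡⟨ cong (λ c → count c r) (+-assoc L (q * L) k) ⟩
    count (L + (q * L + k)) r   ≡⟨ count-L+ (q * L + k) r r<L ⟩
    1 + count (q * L + k) r     ≡⟨ cong suc (count-*L+ q k r r<L) ⟩
    suc q + count k r           ∎
    where open ≡-Reasoning

  count-0≡1+count-rem : ∀ m → ¬ L ∣ m → count m 0 ≡ suc (count m (m % L))
  count-0≡1+count-rem m L∤m = begin
    count m 0                      ≡⟨ cong (λ c → count c 0) m≡qL+r ⟩
    count (q * L + r) 0            ≡⟨ count-*L+ q r 0 (<-≤-trans 0<r (<⇒≤ r<L)) ⟩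
    q + count r 0                  ≡⟨ cong (q +_) (trans (count-≤ r 0 (<⇒≤ r<L)) (sum<-δ-< r 0 0<r)) ⟩
    q + 1                          ≡⟨ trans (+-comm q 1) (cong suc (sym (+-identityʳ q))) ⟩
    suc (q + 0)                    ≡⟨ cong (λ c → suc (q + c)) (trans (count-≤ r r (<⇒≤ r<L)) (sum<-δ-≥ r r ≤-refl)) ⟨
    suc (q + count r r)            ≡⟨ cong suc (count-*L+ q r r r<L) ⟨
    suc (count (q * L + r) r)      ≡⟨ cong (λ c → suc (count c r)) m≡qL+r ⟨
    suc (count m r)                ∎
    where
    open ≡-Reasoning
    q : ℕ
    q = m / L
    r : ℕ
    r = m % L
    r<L : r < L
    r<L = m%n<n m L
    0<r : 0 < r
    0<r = n≢0⇒n>0 (L∤m ∘ m%n≡0⇒n∣m m L)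
    m≡qL+r : m ≡ q * L + r
    m≡qL+r = trans (m≡m%n+[m/n]*n m L) (+-comm r _)

∑-cong : ∀ {n} {f g : Fin n → ℕ} → (∀ k → f k ≡ g k) → ∑ f ≡ ∑ g
∑-cong {zero} f≡g = refl
∑-cong {suc n} f≡g = cong₂ _+_ (f≡g Fin.zero) (∑-cong (f≡g ∘ Fin.suc))

∑-zero : ∀ n → ∑ {n} (λ _ → 0) ≡ 0
∑-zero zero = refl
∑-zero (suc n) = ∑-zero n

∑-distrib-+ : ∀ {n} (f g : Fin n → ℕ) → ∑ (λ k → f k + g k) ≡ ∑ f + ∑ g
∑-distrib-+ {zero} f g = refl
∑-distrib-+ {suc n} f g = trans (cong (f Fin.zero + g Fin.zero +_) (∑-distrib-+ (λ k → f (Fin.suc k)) (λ k → g (Fin.suc k))))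
                                (interchange (f Fin.zero) (g Fin.zero) _ _)

∑-distribˡ-* : ∀ {n} c (f : Fin n → ℕ) → c * ∑ f ≡ ∑ (λ k → c * f k)
∑-distribˡ-* {zero} c f = *-zeroʳ c
∑-distribˡ-* {suc n} c f = trans (*-distribˡ-+ c _ _) (cong (c * f Fin.zero +_) (∑-distribˡ-* c (λ k → f (Fin.suc k))))

∑-distribʳ-* : ∀ {n} c (f : Fin n → ℕ) → ∑ f * c ≡ ∑ (λ k → f k * c)
∑-distribʳ-* c f = trans (*-comm _ c) (trans (∑-distribˡ-* c f) (∑-cong (λ k → *-comm c (f k))))

∑-comm : ∀ {n m} (f : Fin n → Fin m → ℕ) → ∑ (λ i → ∑ (λ j → f i j)) ≡ ∑ (λ j → ∑ (λ i → f i j))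
∑-comm {zero} {m} f = sym (∑-zero m)
∑-comm {suc n} f = trans (cong (∑ (f Fin.zero) +_) (∑-comm (λ i → f (Fin.suc i))))
                         (sym (∑-distrib-+ (f Fin.zero) (λ j → ∑ (λ i → f (Fin.suc i) j))))

∑-δ : ∀ {n} x (x<n : x < n) (f : Fin n → ℕ) → ∑ (λ l → δ (toℕ l) x * f l) ≡ f (fromℕ< x<n)
∑-δ {suc n} zero _ f = begin
  1 * f Fin.zero + ∑ (λ l → 0 * f (Fin.suc l))    ≡⟨ cong (1 * f Fin.zero +_) (∑-zero n) ⟩
  1 * f Fin.zero + 0                              ≡⟨ trans (+-identityʳ _) (*-identityˡ _) ⟩
  f Fin.zero                                      ∎
  where open ≡-Reasoning
∑-δ {suc n} (suc x) (s≤s x<n) f = ∑-δ x x<n (λ l → f (Fin.suc l))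

∑-∣ : ∀ {n} {d} (f : Fin n → ℕ) → (∀ k → d ∣ f k) → d ∣ ∑ f
∑-∣ {zero} {d} f d∣f = d ∣0
∑-∣ {suc n} f d∣f = ∣m∣n⇒∣m+n (d∣f Fin.zero) (∑-∣ (λ k → f (Fin.suc k)) (λ k → d∣f (Fin.suc k)))

∑-% : ∀ {n} d .{{_ : NonZero d}} {f g : Fin n → ℕ} → (∀ k → f k % d ≡ g k % d) → ∑ f % d ≡ ∑ g % d
∑-% {zero} d f≡g = refl
∑-% {suc n} d f≡g = +-cong-% d (f≡g Fin.zero) (∑-% d (f≡g ∘ Fin.suc))

infix 4 _≐_
_≐_ : ∀ {n} → Mat n → Mat n → Set
A ≐ B = ∀ i j → A i j ≡ B i j

⊗-assoc : ∀ {n} (A B C : Mat n) → (A ⊗ B) ⊗ C ≐ A ⊗ (B ⊗ C)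
⊗-assoc A B C i j = begin
  ∑ (λ k → ∑ (λ l → A i l * B l k) * C k j)       ≡⟨ ∑-cong (λ k → ∑-distribʳ-* (C k j) (λ l → A i l * B l k)) ⟩
  ∑ (λ k → ∑ (λ l → A i l * B l k * C k j))       ≡⟨ ∑-comm (λ k l → A i l * B l k * C k j) ⟩
  ∑ (λ l → ∑ (λ k → A i l * B l k * C k j))       ≡⟨ ∑-cong (λ l → ∑-cong (λ k → *-assoc (A i l) (B l k) (C k j))) ⟩
  ∑ (λ l → ∑ (λ k → A i l * (B l k * C k j)))     ≡⟨ ∑-cong (λ l → ∑-distribˡ-* (A i l) (λ k → B l k * C k j)) ⟨
  ∑ (λ l → A i l * ∑ (λ k → B l k * C k j))       ∎
  where open ≡-Reasoning

⊗-distribˡ-⊕ : ∀ {n} (A B C : Mat n) → A ⊗ (B ⊕ C) ≐ (A ⊗ B) ⊕ (A ⊗ C)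
⊗-distribˡ-⊕ A B C i j =
  trans (∑-cong (λ k → *-distribˡ-+ (A i k) (B k j) (C k j))) (∑-distrib-+ (λ k → A i k * B k j) (λ k → A i k * C k j))

⊗-distribʳ-⊕ : ∀ {n} (A B C : Mat n) → (B ⊕ C) ⊗ A ≐ (B ⊗ A) ⊕ (C ⊗ A)
⊗-distribʳ-⊕ A B C i j =
  trans (∑-cong (λ k → *-distribʳ-+ (A k j) (B i k) (C i k))) (∑-distrib-+ (λ k → B i k * A k j) (λ k → C i k * A k j))

⊗-identityˡ : ∀ {n} (A : Mat n) → I n ⊗ A ≐ A
⊗-identityˡ A i j = begin
  ∑ (λ k → δ (toℕ i) (toℕ k) * A k j)   ≡⟨ ∑-cong (λ k → cong (_* A k j) (δ-sym (toℕ i) (toℕ k))) ⟩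
  ∑ (λ k → δ (toℕ k) (toℕ i) * A k j)   ≡⟨ ∑-δ (toℕ i) (toℕ<n i) (λ k → A k j) ⟩
  A (fromℕ< (toℕ<n i)) j                ≡⟨ cong (λ k → A k j) (fromℕ<-toℕ i (toℕ<n i)) ⟩
  A i j                                 ∎
  where open ≡-Reasoning

⊗-identityʳ : ∀ {n} (A : Mat n) → A ⊗ I n ≐ A
⊗-identityʳ A i j = begin
  ∑ (λ k → A i k * δ (toℕ k) (toℕ j))   ≡⟨ ∑-cong (λ k → *-comm (A i k) _) ⟩
  ∑ (λ k → δ (toℕ k) (toℕ j) * A i k)   ≡⟨ ∑-δ (toℕ j) (toℕ<n j) (A i) ⟩
  A i (fromℕ< (toℕ<n j))                ≡⟨ cong (A i) (fromℕ<-toℕ j (toℕ<n j)) ⟩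
  A i j                                 ∎
  where open ≡-Reasoning

⊗-zeroˡ : ∀ {n} (A : Mat n) → Zero n ⊗ A ≐ Zero n
⊗-zeroˡ {n} A i j = ∑-zero n

⊗-zeroʳ : ∀ {n} (A : Mat n) → A ⊗ Zero n ≐ Zero n
⊗-zeroʳ {n} A i j = trans (∑-cong (λ k → *-zeroʳ (A i k))) (∑-zero n)

module Modulo (n d : ℕ) .{{_ : NonZero d}} where

  infix 4 _≈_
  _≈_ : Mat n → Mat n → Set
  A ≈ B = ∀ i j → A i j % d ≡ B i j % d

  ≐⇒≈ : ∀ {A B} → A ≐ B → A ≈ B
  ≐⇒≈ A≐B i j = cong (_% d) (A≐B i j)

  ⊕-cong : ∀ {A A′ B B′} → A ≈ A′ → B ≈ B′ → A ⊕ B ≈ A′ ⊕ B′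
  ⊕-cong A≈A′ B≈B′ i j = +-cong-% d (A≈A′ i j) (B≈B′ i j)

  ⊗-cong : ∀ {A A′ B B′} → A ≈ A′ → B ≈ B′ → A ⊗ B ≈ A′ ⊗ B′
  ⊗-cong A≈A′ B≈B′ i j = ∑-% d (λ k → *-cong-% d (A≈A′ i k) (B≈B′ k j))

  isSemiring : IsSemiring _≈_ _⊕_ _⊗_ (Zero n) (I n)
  isSemiring = record
    { isSemiringWithoutAnnihilatingZero = record
      { +-isCommutativeMonoid = record
        { isMonoid = record
          { isSemigroup = record
            { isMagma = record
              { isEquivalence = record
                { refl = λ i j → refl ; sym = λ e i j → sym (e i j) ; trans = λ e f i j → trans (e i j) (f i j) }
              ; ∙-cong = ⊕-cong }
            ; assoc = λ A B C → ≐⇒≈ (λ i j → +-assoc (A i j) (B i j) (C i j)) }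
          ; identity = (λ A i j → refl) , (λ A → ≐⇒≈ (λ i j → +-identityʳ (A i j))) }
        ; comm = λ A B → ≐⇒≈ (λ i j → +-comm (A i j) (B i j)) }
      ; *-cong = ⊗-cong
      ; *-assoc = λ A B C → ≐⇒≈ (⊗-assoc A B C)
      ; *-identity = (λ A → ≐⇒≈ (⊗-identityˡ A)) , (λ A → ≐⇒≈ (⊗-identityʳ A))
      ; distrib = (λ A B C → ≐⇒≈ (⊗-distribˡ-⊕ A B C)) , (λ A B C → ≐⇒≈ (⊗-distribʳ-⊕ A B C)) }
    ; zero = (λ A → ≐⇒≈ (⊗-zeroˡ A)) , (λ A → ≐⇒≈ (⊗-zeroʳ A)) }

  semiring : Semiring _ _
  semiring = record { isSemiring = isSemiring }

  module ≈-Reasoning = SetoidReasoning (Semiring.setoid semiring)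
  open Semiring semiring public using () renaming (refl to ≈-refl; sym to ≈-sym; trans to ≈-trans; reflexive to ≈-reflexive)
  open import Algebra.Properties.Semiring.Exp semiring public using (^-congˡ; ^-congʳ; ^-assocʳ) renaming (_^_ to _^ᴿ_)
  open import Algebra.Properties.Semiring.Mult semiring public using () renaming (_×_ to _×ᴹ_)
  open GeometricSums semiring public

  ^ᴹ≈^ᴿ : ∀ (M : Mat n) k → M ^ᴹ k ≈ M ^ᴿ k
  ^ᴹ≈^ᴿ M zero = ≈-refl
  ^ᴹ≈^ᴿ M (suc k) = ⊗-cong {M} ≈-refl (^ᴹ≈^ᴿ M k)

  powSum≈geom : ∀ (M : Mat n) k → powSum M k ≈ geom M k
  powSum≈geom M zero = ≈-refl
  powSum≈geom M (suc k) = ⊕-cong (powSum≈geom M k) (^ᴹ≈^ᴿ M k)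

  ×ᴹ-entry : ∀ c (A : Mat n) i j → (c ×ᴹ A) i j ≡ c * A i j
  ×ᴹ-entry zero A i j = refl
  ×ᴹ-entry (suc c) A i j = cong (A i j +_) (×ᴹ-entry c A i j)

  ≡0mod⇒≈0 : ∀ {A} → ≡0mod A d → A ≈ Zero n
  ≡0mod⇒≈0 {A} A≡0 i j = trans (n∣m⇒m%n≡0 (A i j) d (A≡0 i j)) (sym (n∣m⇒m%n≡0 0 d (d ∣0)))

  ≈0⇒≡0mod : ∀ {A} → A ≈ Zero n → ≡0mod A d
  ≈0⇒≡0mod {A} A≈0 i j = m%n≡0⇒n∣m (A i j) d (trans (A≈0 i j) (n∣m⇒m%n≡0 0 d (d ∣0)))

  ∣⇒×ᴹ≈0 : ∀ {c} → d ∣ c → ∀ A → c ×ᴹ A ≈ Zero n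
  ∣⇒×ᴹ≈0 {c} d∣c A = ≡0mod⇒≈0 (λ i j → subst (d ∣_) (sym (×ᴹ-entry c A i j)) (∣m⇒∣m*n (A i j) d∣c))

  ≡0mod-resp-≈ : ∀ {A B} → A ≈ B → ≡0mod B d → ≡0mod A d
  ≡0mod-resp-≈ A≈B B≡0 = ≈0⇒≡0mod (≈-trans A≈B (≡0mod⇒≈0 B≡0))

S^ᴹ-entry : ∀ n .{{_ : NonZero n}} k (i j : Fin n) → (S n ^ᴹ k) i j ≡ δ (toℕ j) ((toℕ i + k) % n)
S^ᴹ-entry n zero i j = trans (δ-sym (toℕ i) (toℕ j)) (cong (δ (toℕ j)) i≡[i+0]%n)
  where
  i≡[i+0]%n : toℕ i ≡ (toℕ i + 0) % n
  i≡[i+0]%n = sym (trans (cong (_% n) (+-identityʳ (toℕ i))) (m<n⇒m%n≡m (toℕ<n i)))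
S^ᴹ-entry n (suc k) i j = begin
  ∑ {n} (λ l → S n i l * (S n ^ᴹ k) l j)                     ≡⟨ ∑-cong {n} (λ l → cong (S n i l *_) (S^ᴹ-entry n k l j)) ⟩
  ∑ {n} (λ l → δ (toℕ l) i′ * δ (toℕ j) ((toℕ l + k) % n))   ≡⟨ ∑-δ i′ i′<n (λ l → δ (toℕ j) ((toℕ l + k) % n)) ⟩
  δ (toℕ j) ((toℕ (fromℕ< i′<n) + k) % n)                    ≡⟨ cong (λ l → δ (toℕ j) ((l + k) % n)) (toℕ-fromℕ< i′<n) ⟩
  δ (toℕ j) ((i′ + k) % n)                                   ≡⟨ cong (δ (toℕ j)) (%-distribˡ-+ i′ k n) ⟩
  δ (toℕ j) ((i′ % n + k % n) % n)                           ≡⟨ cong (λ l → δ (toℕ j) ((l + k % n) % n)) (m%n%n≡m%n (suc (toℕ i)) n) ⟩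
  δ (toℕ j) ((i′ + k % n) % n)                               ≡⟨ cong (δ (toℕ j)) (%-distribˡ-+ (suc (toℕ i)) k n) ⟨
  δ (toℕ j) ((suc (toℕ i) + k) % n)                          ≡⟨ cong (λ l → δ (toℕ j) (l % n)) (+-suc (toℕ i) k) ⟨
  δ (toℕ j) ((toℕ i + suc k) % n)                            ∎
  where
  open ≡-Reasoning
  i′ : ℕ
  i′ = suc (toℕ i) % n
  i′<n : i′ < n
  i′<n = m%n<n (suc (toℕ i)) n

S^ᴹ-∣ : ∀ n .{{_ : NonZero n}} {k} → n ∣ k → S n ^ᴹ k ≐ I n
S^ᴹ-∣ n {k} n∣k i j = trans (S^ᴹ-entry n k i j) (trans (cong (δ (toℕ j)) [i+k]%n≡i) (δ-sym (toℕ j) (toℕ i)))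
  where
  [i+k]%n≡i : (toℕ i + k) % n ≡ toℕ i
  [i+k]%n≡i = trans (%-remove-+ʳ (toℕ i) n∣k) (m<n⇒m%n≡m (toℕ<n i))

≡0mod-⊗ : ∀ {n d e} {A B : Mat n} → ≡0mod A d → ≡0mod B e → ≡0mod (A ⊗ B) (d * e)
≡0mod-⊗ {A = A} {B} A≡0 B≡0 i j = ∑-∣ (λ k → A i k * B k j) (λ k → *-pres-∣ (A≡0 i k) (B≡0 k j))

module Divisible (n m q : ℕ) .{{_ : NonZero n}} .{{_ : NonZero m}} (m≡qn : m ≡ q * n) where
  open Modulo n m

  Sⁿ≈I : S n ^ᴿ n ≈ I n
  Sⁿ≈I = ≈-trans (≈-sym (^ᴹ≈^ᴿ (S n) n)) (≐⇒≈ (S^ᴹ-∣ n ∣-refl))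

  open Periodic n Sⁿ≈I public

  T≈geom : T n m ≈ geom (S n) (q * n)
  T≈geom = ≈-trans (powSum≈geom (S n) m) (≈-reflexive (cong (geom (S n)) m≡qn))

  T≈q×J : T n m ≈ q ×ᴹ J
  T≈q×J = ≈-trans T≈geom (geom-*N≈×J q)

  T²≈0 : T n m ^ᴿ 2 ≈ Zero n
  T²≈0 = ≈-trans (^-congˡ 2 T≈geom) (≈-trans (geom-*N-squared q) (∣⇒×ᴹ≈0 m∣q*qn J))
    where
    m∣q*qn : m ∣ q * (q * n)
    m∣q*qn = divides q (cong (q *_) (sym m≡qn))

n∣m⇒T^n≡0 : ∀ n m .{{_ : NonZero n}} .{{_ : NonZero m}} → n ∣ m → ≡0mod (T n m ^ᴹ n) m
n∣m⇒T^n≡0 (suc zero) m (divides q m≡q*1) =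
  ≈0⇒≡0mod (≈-trans (≐⇒≈ (⊗-identityʳ (T 1 m))) (≈-trans T≈q×J (∣⇒×ᴹ≈0 m∣q J)))
  where
  open Modulo 1 m
  open Divisible 1 m q m≡q*1
  m∣q : m ∣ q
  m∣q = divides 1 (trans (sym (trans m≡q*1 (*-identityʳ q))) (sym (*-identityˡ m)))
n∣m⇒T^n≡0 n@(suc (suc _)) m (divides q m≡qn) =
  ≈0⇒≡0mod (≈-trans (^ᴹ≈^ᴿ (T n m) n) (^-absorbs (T n m) n (s≤s (s≤s z≤n)) T²≈0))
  where
  open Modulo n m
  open Divisible n m q m≡qn

module PrimePower {p} (pr : Prime p) (b : ℕ) where

  instance
    _ = prime⇒nonZero pr
    _ = m^n≢0 p b

  n : ℕ
  n = p ^ b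

  U : ℕ → Mat n
  U c = powSum (S n ^ᴹ (p ^ c)) p

  Uⁿ≡0 : ∀ c → ≡0mod (U c ^ᴹ n) p
  Uⁿ≡0 c = ≈0⇒≡0mod (begin
    U c ^ᴹ n                          ≈⟨ ^ᴹ≈^ᴿ (U c) n ⟩
    U c ^ᴿ n                          ≈⟨ ^-congˡ n (powSum≈geom X p) ⟩
    geom X p ^ᴿ n                     ≈⟨ geom-^p^s b X p ⟩
    geom (X ^ᴿ n) p                   ≈⟨ geom-congˡ p Xⁿ≈I ⟩
    geom (I n) p                      ≈⟨ geom-1 p ⟩
    p ×ᴹ I n                          ≈⟨ ∣⇒×ᴹ≈0 ∣-refl (I n) ⟩
    Zero n                            ∎)
    where
    open Modulo n p
    open CharacteristicPrime pr ∣⇒×ᴹ≈0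
    open ≈-Reasoning
    X : Mat n
    X = S n ^ᴹ (p ^ c)
    Xⁿ≈I : X ^ᴿ n ≈ I n
    Xⁿ≈I = ≈-trans (^-congˡ n (^ᴹ≈^ᴿ (S n) (p ^ c))) (≈-trans (^-assocʳ (S n) (p ^ c) n)
             (≈-trans (≈-sym (^ᴹ≈^ᴿ (S n) (p ^ c * n))) (≐⇒≈ (S^ᴹ-∣ n (n∣m*n (p ^ c))))))

  Tⁿ≡0 : ∀ a → ≡0mod (T n (p ^ a) ^ᴹ n) (p ^ a)
  Tⁿ≡0 zero i j = 1∣ _
  Tⁿ≡0 (suc a) = ≡0mod-resp-≈ split (≡0mod-⊗ (Uⁿ≡0 a) (Tⁿ≡0 a))
    where
    instance
      _ = m^n≢0 p (suc a)
    open Modulo n (p ^ suc a)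
    open ≈-Reasoning
    Y : Mat n
    Y = S n ^ᴿ (p ^ a)
    U≈geom : U a ≈ geom Y p
    U≈geom = ≈-trans (powSum≈geom _ p) (geom-congˡ p (^ᴹ≈^ᴿ (S n) (p ^ a)))
    S-commutes-Y : Commute (S n) Y
    S-commutes-Y = commute-^ʳ {S n} {S n} ≈-refl (p ^ a)
    commutes : Commute (geom Y p) (geom (S n) (p ^ a))
    commutes = commute-geomʳ {geom Y p} {S n} (≈-sym (commute-geomʳ {S n} {Y} S-commutes-Y p)) (p ^ a)
    split : T n (p ^ suc a) ^ᴹ n ≈ (U a ^ᴹ n) ⊗ (T n (p ^ a) ^ᴹ n)
    split = begin
      T n (p ^ suc a) ^ᴹ n                          ≈⟨ ^ᴹ≈^ᴿ _ n ⟩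
      T n (p ^ suc a) ^ᴿ n                          ≈⟨ ^-congˡ n (powSum≈geom (S n) (p ^ suc a)) ⟩
      geom (S n) (p * p ^ a) ^ᴿ n                   ≈⟨ ^-congˡ n (geom-* (S n) p (p ^ a)) ⟩
      (geom Y p ⊗ geom (S n) (p ^ a)) ^ᴿ n          ≈⟨ commute-*-^ commutes n ⟩
      (geom Y p ^ᴿ n) ⊗ (geom (S n) (p ^ a) ^ᴿ n)   ≈⟨ ⊗-cong (^-congˡ n U≈geom) (^-congˡ n (powSum≈geom (S n) (p ^ a))) ⟨
      (U a ^ᴿ n) ⊗ (T n (p ^ a) ^ᴿ n)               ≈⟨ ⊗-cong (^ᴹ≈^ᴿ (U a) n) (^ᴹ≈^ᴿ _ n) ⟨
      (U a ^ᴹ n) ⊗ (T n (p ^ a) ^ᴹ n)               ∎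

module ResidueSums (n L : ℕ) .{{_ : NonZero n}} .{{_ : NonZero L}} (L∣n : L ∣ n) where

  row₀ : Fin n
  row₀ = fromℕ< (>-nonZero⁻¹ n)

  residueSum : ℕ → Mat n → ℕ
  residueSum r M = ∑ {n} (λ j → δ (toℕ j % L) r * M row₀ j)

  residueSum-% : ∀ d .{{_ : NonZero d}} r {A B} → Modulo._≈_ n d A B → residueSum r A % d ≡ residueSum r B % d
  residueSum-% d r A≈B = ∑-% {n} d (λ j → *-cong-% d {δ (toℕ j % L) r} refl (A≈B row₀ j))

  residueSum-Zero : ∀ r → residueSum r (Zero n) ≡ 0
  residueSum-Zero r = trans (∑-cong {n} (λ j → *-zeroʳ (δ (toℕ j % L) r))) (∑-zero n)

  residueSum-powSum : ∀ r Y k → residueSum r (powSum Y k) ≡ sum< k (λ i → residueSum r (Y ^ᴹ i))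
  residueSum-powSum r Y zero = residueSum-Zero r
  residueSum-powSum r Y (suc k) = trans (∑-cong {n} (λ j → *-distribˡ-+ (δ (toℕ j % L) r) _ _))
    (trans (∑-distrib-+ {n} _ _) (cong (_+ residueSum r (Y ^ᴹ k)) (residueSum-powSum r Y k)))

  residueSum-S^ : ∀ r k → residueSum r (S n ^ᴹ k) ≡ δ (k % L) r
  residueSum-S^ r k = begin
    ∑ {n} (λ j → δ (toℕ j % L) r * (S n ^ᴹ k) row₀ j)      ≡⟨ ∑-cong {n} (λ j → trans (cong (δ (toℕ j % L) r *_) (S^ᴹ-entry n k row₀ j))
                                                                                  (*-comm (δ (toℕ j % L) r) _)) ⟩
    ∑ {n} (λ j → δ (toℕ j) c * δ (toℕ j % L) r)             ≡⟨ ∑-δ {n} c c<n (λ j → δ (toℕ j % L) r) ⟩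
    δ (toℕ (fromℕ< c<n) % L) r                              ≡⟨ cong (λ c → δ (c % L) r) (toℕ-fromℕ< c<n) ⟩
    δ ((toℕ row₀ + k) % n % L) r                            ≡⟨ cong (λ c → δ c r) (m∣n⇒o%n%m≡o%m L n _ L∣n) ⟩
    δ ((toℕ row₀ + k) % L) r                                ≡⟨ cong (λ c → δ ((c + k) % L) r) (toℕ-fromℕ< (>-nonZero⁻¹ n)) ⟩
    δ (k % L) r                                             ∎
    where
    open ≡-Reasoning
    c : ℕ
    c = (toℕ row₀ + k) % n
    c<n : c < n
    c<n = m%n<n (toℕ row₀ + k) n

p∣residue-counts : ∀ {n m p L} .{{_ : NonZero n}} .{{_ : NonZero m}} .{{_ : NonZero L}} →
                   Prime p → p ∣ m → L ∣ n → ∀ {K} s → K ≤ p ^ s → p ^ s % L ≡ 1 % L →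
                   ≡0mod (T n m ^ᴹ K) m → ∀ r → p ∣ Residues.count L m r
p∣residue-counts {n} {m} {p} {L} pr p∣m L∣n {K} s K≤e e≡1 Tᴷ≡0 r = m%n≡0⇒n∣m _ p count≡0
  where
  instance
    _ = prime⇒nonZero pr
  open Modulo n p
  open CharacteristicPrime pr ∣⇒×ᴹ≈0
  open ResidueSums n L L∣n
  open Residues L
  e : ℕ
  e = p ^ s
  X : Mat n
  X = S n ^ᴹ e
  powSum-X≈0 : powSum X m ≈ Zero n
  powSum-X≈0 = begin
    powSum X m          ≈⟨ powSum≈geom X m ⟩
    geom X m            ≈⟨ geom-congˡ m (^ᴹ≈^ᴿ (S n) e) ⟩
    geom (S n ^ᴿ e) m   ≈⟨ geom-^p^s s (S n) m ⟨
    geom (S n) m ^ᴿ e   ≈⟨ ^-congˡ e (powSum≈geom (S n) m) ⟨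
    T n m ^ᴿ e          ≈⟨ ^-absorbs (T n m) e K≤e Tᴷ≈0 ⟩
    Zero n              ∎
    where
    open ≈-Reasoning
    Tᴷ≈0 : T n m ^ᴿ K ≈ Zero n
    Tᴷ≈0 = ≈-trans (≈-sym (^ᴹ≈^ᴿ _ K)) (≡0mod⇒≈0 (λ i j → ∣-trans p∣m (Tᴷ≡0 i j)))
  Xⁱ-residue : ∀ i → residueSum r (X ^ᴹ i) % p ≡ δ (i % L) r % p
  Xⁱ-residue i = begin
    residueSum r (X ^ᴹ i) % p           ≡⟨ residueSum-% p r Xⁱ≈S^ei ⟩
    residueSum r (S n ^ᴹ (e * i)) % p   ≡⟨ cong (_% p) (residueSum-S^ r (e * i)) ⟩
    δ ((e * i) % L) r % p               ≡⟨ cong (λ c → δ c r % p) (*-%≡1 L e≡1 i) ⟩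
    δ (i % L) r % p                     ∎
    where
    open ≡-Reasoning
    Xⁱ≈S^ei : X ^ᴹ i ≈ S n ^ᴹ (e * i)
    Xⁱ≈S^ei = ≈-trans (^ᴹ≈^ᴿ X i) (≈-trans (^-congˡ i (^ᴹ≈^ᴿ (S n) e))
                (≈-trans (^-assocʳ (S n) e i) (≈-sym (^ᴹ≈^ᴿ (S n) (e * i)))))
  count≡0 : count m r % p ≡ 0
  count≡0 = begin
    count m r % p                                 ≡⟨ sum<-% m p Xⁱ-residue ⟨
    sum< m (λ i → residueSum r (X ^ᴹ i)) % p       ≡⟨ cong (_% p) (residueSum-powSum r X m) ⟨
    residueSum r (powSum X m) % p                 ≡⟨ residueSum-% p r powSum-X≈0 ⟩
    residueSum r (Zero n) % p                     ≡⟨ cong (_% p) (residueSum-Zero r) ⟩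
    0 % p                                         ≡⟨ n∣m⇒m%n≡0 0 p (p ∣0) ⟩
    0                                             ∎
    where open ≡-Reasoning

nilpotent⇒∣ : ∀ {n m p L K} .{{_ : NonZero n}} .{{_ : NonZero m}} → Prime p → p ∣ m → L ∣ n → ¬ p ∣ L →
              ≡0mod (T n m ^ᴹ K) m → L ∣ m
nilpotent⇒∣ {n} {m} {p} {L} {K} pr p∣m L∣n p∤L Tᴷ≡0 with L ∣? m
... | yes L∣m = L∣m
... | no L∤m with large-prime-power≡1-mod pr L {{∣-nonZero L∣n}} p∤L K
... | s , K≤pˢ , pˢ≡1 = contradiction (subst Prime (∣1⇒≡1 p∣1) pr) ¬prime[1]
  where
  instance
    _ = ∣-nonZero L∣n
  p∣count : ∀ r → p ∣ Residues.count L m r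
  p∣count = p∣residue-counts pr p∣m L∣n s K≤pˢ pˢ≡1 Tᴷ≡0
  p∣1 : p ∣ 1
  p∣1 = ∣m+n∣m⇒∣n (subst (p ∣_) (trans (Residues.count-0≡1+count-rem L m L∤m) (+-comm 1 _)) (p∣count 0))
                   (p∣count (m % L))

≡0mod? : ∀ {n} (M : Mat n) m → Dec (≡0mod M m)
≡0mod? M m = all? (λ i → all? (λ j → m ∣? M i j))

LeastPositive : (ℕ → Set) → ℕ → Set
LeastPositive P k = 0 < k × P k × (∀ j → 0 < j → j < k → ¬ P j)

least-positive : ∀ {P : ℕ → Set} → (∀ k → Dec (P k)) →
                 ∀ {K} → 0 < K → P K → ∃ λ k → LeastPositive P k × k ≤ K
least-positive {P} P? {K} 0<K PK with search K
  where
  search : ∀ K → (∃ λ k → LeastPositive P k × k ≤ K) ⊎ (∀ j → 0 < j → j ≤ K → ¬ P j)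
  search zero = inj₂ (λ j 0<j j≤0 → contradiction j≤0 (<⇒≱ 0<j))
  search (suc K) with search K | P? (suc K)
  ... | inj₁ (k , least , k≤K) | _ = inj₁ (k , least , ≤-trans k≤K (n≤1+n K))
  ... | inj₂ none | yes P[1+K] = inj₁ (suc K , (z<s , P[1+K] , λ j 0<j j<1+K → none j 0<j (s≤s⁻¹ j<1+K)) , ≤-refl)
  ... | inj₂ none | no ¬P[1+K] = inj₂ λ j 0<j j≤1+K →
    [ (λ j<1+K → none j 0<j (s≤s⁻¹ j<1+K)) , (λ { refl → ¬P[1+K] }) ]′ (m≤n⇒m<n∨m≡n j≤1+K)
... | inj₁ found = found
... | inj₂ none = contradiction PK (none K 0<K ≤-refl)

T^n≡0 : ∀ n m .{{_ : NonZero n}} .{{_ : NonZero m}} →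
        SamePrimePowers m n ⊎ (TwoPrimeFactors m × n ∣ m) → ≡0mod (T n m ^ᴹ n) m
T^n≡0 n m (inj₂ (_ , n∣m)) = n∣m⇒T^n≡0 n m n∣m
T^n≡0 _ _ (inj₁ (p , pr , (a , refl) , (b , refl))) = PrimePower.Tⁿ≡0 pr b a

corollary1 : (n m : ℕ) → .{{_ : NonZero n}} → 1 < m →
    (NilpotentMod (T n m) m ⇔ (SamePrimePowers m n ⊎ (TwoPrimeFactors m × n ∣ m)))
    × (NilpotentMod (T n m) m → ∃ λ k → IsNilpotentIndex (T n m) m k × k ≤ n)
corollary1 n m 1<m = mk⇔ necessary sufficient , index-≤
  where
  instance
    _ = >-nonZero (<-trans z<s 1<m)
  necessary : NilpotentMod (T n m) m → SamePrimePowers m n ⊎ (TwoPrimeFactors m × n ∣ m)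
  necessary (K , _ , Tᴷ≡0) =
    coprime-parts∣⇒classification 1<m (λ pr p∣m L∣n p∤L → nilpotent⇒∣ {K = K} pr p∣m L∣n p∤L Tᴷ≡0)
  sufficient : SamePrimePowers m n ⊎ (TwoPrimeFactors m × n ∣ m) → NilpotentMod (T n m) m
  sufficient c = n , >-nonZero⁻¹ n , T^n≡0 n m c
  index-≤ : NilpotentMod (T n m) m → ∃ λ k → IsNilpotentIndex (T n m) m k × k ≤ n
  index-≤ nil = least-positive (λ k → ≡0mod? (T n m ^ᴹ k) m) (>-nonZero⁻¹ n) (T^n≡0 n m (necessary nil))
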